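{- Let $\mathbf{C}$ be a quasitopos and let $\rho$ be a classifying PBPO$^+$ rule. If $G_L\Rightarrow^{\rho}_{(m,\alpha)}G_R$ and $G_L\Rightarrow^{\rho}_{(m,\beta)}G_R'$ are PBPO$^+$ steps with the same match $m$, then $\alpha=\beta$ and $G_R\cong G_R'$.
   Context: A quasitopos is a category with all finite limits and colimits that is locally cartesian closed and has a regular-subobject classifier. Its regular monos form a stable system of monics $\mathcal{M}$, and it has an $\mathcal{M}$-partial map classifier $(T,\eta)$: a functor $T$ and natural transformation $\eta:\mathrm{Id}\to T$ with each $\eta_X\in\mathcal{M}$ such that for every span $A\xleftarrow{m}X\xrightarrow{f}B$ with $m\in\mathcal{M}$ there is a unique $[m,f]:A\to T(B)$ making $\eta_B\circ f=[m,f]\circ m$ a pullback. A regular mono $t_L:L\to L'$ is a restricted classifier if there is a monomorphism $s:L'\to T(L)$ with $s\circ t_L=\eta_L$. PBPO$^+$ rule $\rho$: morphisms $l:K\to L$, $r:K\to R$, $t_L:L\to L'$, $t_K:K\to K'$, $l':K'\to L'$ with $t_L\circ l=l'\circ t_K$ a pullback. $\rho$ is classifying if $t_L$ is a regular mono that is a restricted classifier. PBPO$^+$ step $G_L\Rightarrow^{\rho}_{(m,\alpha)}G_R$ with $m:L\to G_L$, $\alpha:G_L\to L'$: $\alpha m=t_L$ and $L\xleftarrow{1_L}L\xrightarrow{m}G_L$ is a pullback of $L\xrightarrow{t_L}L'\xleftarrow{\alpha}G_L$; $G_L\xleftarrow{g_L}G_K\xrightarrow{u'}K'$ is a pullback of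 $\alpha,l'$; $u:K\to G_K$ is the unique morphism with $u'u=t_K$; $G_K\xrightarrow{g_R}G_R\xleftarrow{w}R$ is a pushout of $G_K\xleftarrow{u}K\xrightarrow{r}R$. -}

module Defs where

open import Level using (Level; _⊔_) renaming (suc to lsuc)
open import Data.Product using (Σ; _×_; _,_; Σ-syntax)
open import Relation.Binary.PropositionalEquality using (_≡_)

record Category (o ℓ : Level) : Set (lsuc (o ⊔ ℓ)) where
  infixr 9 _∘_
  field
    Obj       : Set o
    Hom       : Obj → Obj → Set ℓ
    id        : ∀ {A} → Hom A A
    _∘_       : ∀ {A B C} → Hom B C → Hom A B → Hom A C
    identityˡ : ∀ {A B} {f : Hom A B} → id ∘ f ≡ f
    identityʳ : ∀ {A B} {f : Hom A B} → f ∘ id ≡ f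
    assoc     : ∀ {A B C D} {f : Hom A B} {g : Hom B C} {h : Hom C D} →
                (h ∘ g) ∘ f ≡ h ∘ (g ∘ f)

∃! : ∀ {a p} (A : Set a) → (A → Set p) → Set (a ⊔ p)
∃! A P = Σ[ x ∈ A ] (P x × (∀ y → P y → y ≡ x))

module Cat {o ℓ : Level} (C : Category o ℓ) where
  open Category C

  Mono : ∀ {A B} → Hom A B → Set (o ⊔ ℓ)
  Mono {A} m = ∀ {X} (f g : Hom X A) → m ∘ f ≡ m ∘ g → f ≡ g

  IsIso : ∀ {A B} → Hom A B → Set ℓ
  IsIso {A} {B} f = Σ[ g ∈ Hom B A ] ((g ∘ f ≡ id) × (f ∘ g ≡ id))

  _≅_ : Obj → Obj → Set ℓ
  A ≅ B = Σ[ f ∈ Hom A B ] IsIso f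

  IsPullback : ∀ {P A B Z} → Hom P A → Hom P B → Hom A Z → Hom B Z → Set (o ⊔ ℓ)
  IsPullback {P} {A} {B} p₁ p₂ f g =
    (f ∘ p₁ ≡ g ∘ p₂) ×
    (∀ {X} (h₁ : Hom X A) (h₂ : Hom X B) → f ∘ h₁ ≡ g ∘ h₂ →
       ∃! (Hom X P) (λ u → (p₁ ∘ u ≡ h₁) × (p₂ ∘ u ≡ h₂)))

  IsPushout : ∀ {Z A B P} → Hom Z A → Hom Z B → Hom A P → Hom B P → Set (o ⊔ ℓ)
  IsPushout {Z} {A} {B} {P} f g i₁ i₂ =
    (i₁ ∘ f ≡ i₂ ∘ g) ×
    (∀ {X} (h₁ : Hom A X) (h₂ : Hom B X) → h₁ ∘ f ≡ h₂ ∘ g →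
       ∃! (Hom P X) (λ u → (u ∘ i₁ ≡ h₁) × (u ∘ i₂ ≡ h₂)))

  IsEqualizer : ∀ {E A B} → Hom E A → Hom A B → Hom A B → Set (o ⊔ ℓ)
  IsEqualizer {E} {A} e f g =
    (f ∘ e ≡ g ∘ e) ×
    (∀ {X} (h : Hom X A) → f ∘ h ≡ g ∘ h → ∃! (Hom X E) (λ u → e ∘ u ≡ h))

  RegularMono : ∀ {A B} → Hom A B → Set (o ⊔ ℓ)
  RegularMono {A} {B} m = Σ[ Z ∈ Obj ] Σ[ f ∈ Hom B Z ] Σ[ g ∈ Hom B Z ] IsEqualizer m f g

  -- Exponential of (q : B → X) by (p : A → X) in the slice C/X.
  -- The binary product in C/X of (e : E → X) and (p : A → X) is their pullback.
  record SliceExponential {X A B : Obj} (p : Hom A X) (q : Hom B X) : Set (o ⊔ ℓ) where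
    field
      E      : Obj
      e      : Hom E X
      P      : Obj
      π₁     : Hom P E
      π₂     : Hom P A
      pb     : IsPullback π₁ π₂ e p
      ev     : Hom P B
      ev-map : q ∘ ev ≡ e ∘ π₁
      curry  : ∀ {Z Q} (z : Hom Z X) (σ₁ : Hom Q Z) (σ₂ : Hom Q A) →
               IsPullback σ₁ σ₂ z p →
               (h : Hom Q B) → q ∘ h ≡ z ∘ σ₁ →
               ∃! (Hom Z E) (λ k → (e ∘ k ≡ z) ×
                   (∀ (j : Hom Q P) → π₁ ∘ j ≡ k ∘ σ₁ → π₂ ∘ j ≡ σ₂ → ev ∘ j ≡ h))

  record IsQuasitopos : Set (o ⊔ ℓ) where
    field
      -- finite limits: terminal object and pullbacks
      ⊤          : Obj
      !          : ∀ {X} → Hom X ⊤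
      !-unique   : ∀ {X} (f : Hom X ⊤) → f ≡ !
      pullback   : ∀ {A B Z} (f : Hom A Z) (g : Hom B Z) →
                   Σ[ P ∈ Obj ] Σ[ p₁ ∈ Hom P A ] Σ[ p₂ ∈ Hom P B ] IsPullback p₁ p₂ f g
      -- finite colimits: initial object and pushouts
      ⊥          : Obj
      ¡          : ∀ {X} → Hom ⊥ X
      ¡-unique   : ∀ {X} (f : Hom ⊥ X) → f ≡ ¡
      pushout    : ∀ {Z A B} (f : Hom Z A) (g : Hom Z B) →
                   Σ[ P ∈ Obj ] Σ[ i₁ ∈ Hom A P ] Σ[ i₂ ∈ Hom B P ] IsPushout f g i₁ i₂
      -- locally cartesian closed: every slice C/X is cartesian closed
      -- (finite products in C/X are given by id_X and pullbacks)
      slice-exp  : ∀ {X A B} (p : Hom A X) (q : Hom B X) → SliceExponential p q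
      Ω          : Obj
      true       : Hom ⊤ Ω
      classify   : ∀ {A X} (m : Hom A X) → RegularMono m →
                   ∃! (Hom X Ω) (λ χ → IsPullback m ! χ true)

  record PartialMapClassifier : Set (o ⊔ ℓ) where
    field
      T₀       : Obj → Obj
      T₁       : ∀ {A B} → Hom A B → Hom (T₀ A) (T₀ B)
      T-id     : ∀ {A} → T₁ (id {A}) ≡ id
      T-∘      : ∀ {A B D} (f : Hom A B) (g : Hom B D) → T₁ (g ∘ f) ≡ T₁ g ∘ T₁ f
      η        : ∀ X → Hom X (T₀ X)
      η-nat    : ∀ {A B} (f : Hom A B) → T₁ f ∘ η A ≡ η B ∘ f
      η-reg    : ∀ X → RegularMono (η X)
      classify : ∀ {A X B} (m : Hom X A) (f : Hom X B) → RegularMono m →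
                 ∃! (Hom A (T₀ B)) (λ g → IsPullback m f g (η B))

  RestrictedClassifier : ∀ {L L'} → Hom L L' → Set (o ⊔ ℓ)
  RestrictedClassifier {L} {L'} tL =
    Σ[ TC ∈ PartialMapClassifier ]
      (let open PartialMapClassifier TC in
       Σ[ s ∈ Hom L' (T₀ L) ] (Mono s × (s ∘ tL ≡ η L)))

  record Rule : Set (o ⊔ ℓ) where
    field
      L K R L' K' : Obj
      l   : Hom K L
      r   : Hom K R
      tL  : Hom L L'
      tK  : Hom K K'
      l'  : Hom K' L'
      pb  : IsPullback l tK tL l'

  Classifying : Rule → Set (o ⊔ ℓ)
  Classifying ρ = RegularMono tL × RestrictedClassifier tL
    where open Rule ρ

  record Step (ρ : Rule) {GL : Obj} (m : Hom (Rule.L ρ) GL)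
              (α : Hom GL (Rule.L' ρ)) (GR : Obj) : Set (o ⊔ ℓ) where
    open Rule ρ
    field
      αm     : α ∘ m ≡ tL
      pb-m   : IsPullback id m tL α
      GK     : Obj
      gL     : Hom GK GL
      u'     : Hom GK K'
      pb-GK  : IsPullback gL u' α l'
      u      : Hom K GK
      u'u    : u' ∘ u ≡ tK
      u-uniq : ∀ (v : Hom K GK) → u' ∘ v ≡ tK → v ≡ u
      gR     : Hom GK GR
      w      : Hom R GR
      po     : IsPushout u r gR w

module Submission where

open import Defs
open import Data.Product using (_×_; _,_; Σ-syntax)
open import Relation.Binary.PropositionalEquality
  using (_≡_; refl; sym; trans; cong; subst; module ≡-Reasoning)

-- The adherence α is forced: composing the pullback square of the match with the
-- mono s : L' → T L exhibits s ∘ α as the partial-map classifier of the span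
-- G_L ←m─ L ─1→ L, so s ∘ α = s ∘ β and hence α = β. With α fixed, G_K and then
-- G_R are a pullback and a pushout of the same diagram up to isomorphism.

module _ {o ℓ} (C : Category o ℓ) where
  open Category C
  open Cat C
  open ≡-Reasoning

  pullback-swap : ∀ {P A B Z} {p₁ : Hom P A} {p₂ : Hom P B} {f : Hom A Z} {g : Hom B Z} →
                  IsPullback p₁ p₂ f g → IsPullback p₂ p₁ g f
  pullback-swap (comm , univ) = sym comm , λ h₁ h₂ e →
    let (k , (k₂ , k₁) , unique) = univ h₂ h₁ (sym e)
    in k , (k₁ , k₂) , λ y (y₁ , y₂) → unique y (y₂ , y₁)

  pullback-postcompose-mono : ∀ {P A B Z W} {p₁ : Hom P A} {p₂ : Hom P B}
                              {f : Hom A Z} {g : Hom B Z} {s : Hom Z W} →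
                              Mono s → IsPullback p₁ p₂ f g → IsPullback p₁ p₂ (s ∘ f) (s ∘ g)
  pullback-postcompose-mono {p₁ = p₁} {p₂} {f} {g} {s} s-mono (comm , univ) =
    comm′ , λ h₁ h₂ e → univ h₁ h₂ (s-mono (f ∘ h₁) (g ∘ h₂) (trans (sym assoc) (trans e assoc)))
    where
      comm′ : (s ∘ f) ∘ p₁ ≡ (s ∘ g) ∘ p₂
      comm′ = trans assoc (trans (cong (s ∘_) comm) (sym assoc))

  -- If f is the equalizer of a and b, then p₂ is the equalizer of a ∘ g and b ∘ g.
  regular-mono-pullback-stable : ∀ {P A B Z} {p₁ : Hom P A} {p₂ : Hom P B}
                                 {f : Hom A Z} {g : Hom B Z} →
                                 RegularMono f → IsPullback p₁ p₂ f g → RegularMono p₂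
  regular-mono-pullback-stable {p₁ = p₁} {p₂} {f} {g} (W , a , b , (eq , equalize)) (comm , univ) =
    W , a ∘ g , b ∘ g , (equalizes , universal)
    where
      equalizes : (a ∘ g) ∘ p₂ ≡ (b ∘ g) ∘ p₂
      equalizes = begin
        (a ∘ g) ∘ p₂ ≡⟨ assoc ⟩
        a ∘ (g ∘ p₂) ≡⟨ cong (a ∘_) (sym comm) ⟩
        a ∘ (f ∘ p₁) ≡⟨ sym assoc ⟩
        (a ∘ f) ∘ p₁ ≡⟨ cong (_∘ p₁) eq ⟩
        (b ∘ f) ∘ p₁ ≡⟨ assoc ⟩
        b ∘ (f ∘ p₁) ≡⟨ cong (b ∘_) comm ⟩
        b ∘ (g ∘ p₂) ≡⟨ sym assoc ⟩
        (b ∘ g) ∘ p₂ ∎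
      universal : ∀ {X} (h : Hom X _) → (a ∘ g) ∘ h ≡ (b ∘ g) ∘ h → ∃! (Hom X _) (λ v → p₂ ∘ v ≡ h)
      universal h e =
        let (k , fk≡gh , k-unique) = equalize (g ∘ h) (trans (sym assoc) (trans e assoc))
            (v , (p₁v≡k , p₂v≡h) , v-unique) = univ k h fk≡gh
            through-k : ∀ y → p₂ ∘ y ≡ h → p₁ ∘ y ≡ k
            through-k y p₂y≡h = k-unique (p₁ ∘ y)
              (trans (sym assoc) (trans (cong (_∘ y) comm) (trans assoc (cong (g ∘_) p₂y≡h))))
        in v , p₂v≡h , λ y p₂y≡h → v-unique y (through-k y p₂y≡h , p₂y≡h)

  pullback-endo-id : ∀ {P A B Z} {p₁ : Hom P A} {p₂ : Hom P B} {f : Hom A Z} {g : Hom B Z} →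
                     IsPullback p₁ p₂ f g → (h : Hom P P) → p₁ ∘ h ≡ p₁ → p₂ ∘ h ≡ p₂ → h ≡ id
  pullback-endo-id {p₁ = p₁} {p₂} (comm , univ) h e₁ e₂ =
    let (_ , _ , unique) = univ p₁ p₂ comm
    in trans (unique h (e₁ , e₂)) (sym (unique id (identityʳ , identityʳ)))

  pushout-endo-id : ∀ {Z A B P} {f : Hom Z A} {g : Hom Z B} {i₁ : Hom A P} {i₂ : Hom B P} →
                    IsPushout f g i₁ i₂ → (h : Hom P P) → h ∘ i₁ ≡ i₁ → h ∘ i₂ ≡ i₂ → h ≡ id
  pushout-endo-id {i₁ = i₁} {i₂} (comm , univ) h e₁ e₂ =
    let (_ , _ , unique) = univ i₁ i₂ comm
    in trans (unique h (e₁ , e₂)) (sym (unique id (identityˡ , identityˡ)))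

  compose-triangles : ∀ {A B C D} {x : Hom A B} {y : Hom A C} {z : Hom A D}
                      {F : Hom B C} {G : Hom C D} →
                      F ∘ x ≡ y → G ∘ y ≡ z → (G ∘ F) ∘ x ≡ z
  compose-triangles {G = G} Fx≡y Gy≡z = trans assoc (trans (cong (G ∘_) Fx≡y) Gy≡z)

  paste-triangles : ∀ {A B C D} {a : Hom C D} {b : Hom B C} {c : Hom B D} {d : Hom A B} {e : Hom A D} →
                    a ∘ b ≡ c → c ∘ d ≡ e → a ∘ (b ∘ d) ≡ e
  paste-triangles {d = d} ab≡c cd≡e = trans (sym assoc) (trans (cong (_∘ d) ab≡c) cd≡e)

  round-trip : ∀ {A B X Y} {i : Hom X A} {j : Hom Y B} {φ : Hom X Y} {ψ : Hom Y X}
               {F : Hom A B} {G : Hom B A} →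
               F ∘ i ≡ j ∘ φ → G ∘ j ≡ i ∘ ψ → ψ ∘ φ ≡ id → (G ∘ F) ∘ i ≡ i
  round-trip {i = i} {j} {φ} {ψ} {F} {G} Fi≡jφ Gj≡iψ ψφ≡id = begin
    (G ∘ F) ∘ i   ≡⟨ assoc ⟩
    G ∘ (F ∘ i)   ≡⟨ cong (G ∘_) Fi≡jφ ⟩
    G ∘ (j ∘ φ)   ≡⟨ sym assoc ⟩
    (G ∘ j) ∘ φ   ≡⟨ cong (_∘ φ) Gj≡iψ ⟩
    (i ∘ ψ) ∘ φ   ≡⟨ assoc ⟩
    i ∘ (ψ ∘ φ)   ≡⟨ cong (i ∘_) ψφ≡id ⟩
    i ∘ id        ≡⟨ identityʳ ⟩
    i             ∎

  pullbacks-iso : ∀ {P Q A B Z} {p₁ : Hom P A} {p₂ : Hom P B} {q₁ : Hom Q A} {q₂ : Hom Q B}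
                  {f : Hom A Z} {g : Hom B Z} →
                  IsPullback p₁ p₂ f g → IsPullback q₁ q₂ f g →
                  Σ[ φ ∈ Hom P Q ] ((q₁ ∘ φ ≡ p₁) × (q₂ ∘ φ ≡ p₂)) × IsIso φ
  pullbacks-iso pb@(comm , univ) pb′@(comm′ , univ′) =
    let (φ , (φ₁ , φ₂) , _) = univ′ _ _ comm
        (ψ , (ψ₁ , ψ₂) , _) = univ _ _ comm′
    in φ , (φ₁ , φ₂) , ψ
       , pullback-endo-id pb (ψ ∘ φ) (paste-triangles ψ₁ φ₁) (paste-triangles ψ₂ φ₂)
       , pullback-endo-id pb′ (φ ∘ ψ) (paste-triangles φ₁ ψ₁) (paste-triangles φ₂ ψ₂)

  pushout-comparison : ∀ {Z A A′ B P P′} {f : Hom Z A} {f′ : Hom Z A′} {g : Hom Z B}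
                       {i₁ : Hom A P} {i₂ : Hom B P} {j₁ : Hom A′ P′} {j₂ : Hom B P′} →
                       IsPushout f g i₁ i₂ → IsPushout f′ g j₁ j₂ →
                       (φ : Hom A A′) → φ ∘ f ≡ f′ →
                       Σ[ F ∈ Hom P P′ ] (F ∘ i₁ ≡ j₁ ∘ φ) × (F ∘ i₂ ≡ j₂)
  pushout-comparison {j₁ = j₁} (_ , univ) (comm′ , _) φ φf≡f′ =
    let (F , commutes , _) = univ _ _ (trans assoc (trans (cong (j₁ ∘_) φf≡f′) comm′))
    in F , commutes

  pushouts-iso-along : ∀ {Z A A′ B P P′} {f : Hom Z A} {f′ : Hom Z A′} {g : Hom Z B}
                       {i₁ : Hom A P} {i₂ : Hom B P} {j₁ : Hom A′ P′} {j₂ : Hom B P′} →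
                       IsPushout f g i₁ i₂ → IsPushout f′ g j₁ j₂ →
                       (φ : Hom A A′) → IsIso φ → φ ∘ f ≡ f′ → P ≅ P′
  pushouts-iso-along {f = f} {f′} po po′ φ (ψ , ψφ≡id , φψ≡id) φf≡f′ =
    let (F , Fi₁ , Fi₂) = pushout-comparison po po′ φ φf≡f′
        (G , Gj₁ , Gj₂) = pushout-comparison po′ po ψ ψf′≡f
    in F , G
       , pushout-endo-id po (G ∘ F) (round-trip Fi₁ Gj₁ ψφ≡id) (compose-triangles Fi₂ Gj₂)
       , pushout-endo-id po′ (F ∘ G) (round-trip Gj₁ Fi₁ φψ≡id) (compose-triangles Gj₂ Fi₂)
    where
      ψf′≡f : ψ ∘ f′ ≡ f
      ψf′≡f = begin
        ψ ∘ f′        ≡⟨ cong (ψ ∘_) (sym φf≡f′) ⟩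
        ψ ∘ (φ ∘ f)   ≡⟨ sym assoc ⟩
        (ψ ∘ φ) ∘ f   ≡⟨ cong (_∘ f) ψφ≡id ⟩
        id ∘ f        ≡⟨ identityˡ ⟩
        f             ∎

  restricted-classifier-pullback-unique : ∀ {L L′ G} {t : Hom L L′} {m : Hom L G} {α β : Hom G L′} →
                                          RegularMono t → RestrictedClassifier t →
                                          IsPullback id m t α → IsPullback id m t β → α ≡ β
  restricted-classifier-pullback-unique {L} {t = t} {m} {α} {β} t-reg (TC , s , s-mono , st≡η) pbα pbβ =
    let (_ , _ , unique) = classify m id (regular-mono-pullback-stable t-reg pbα)
    in s-mono α β (trans (unique (s ∘ α) (classified pbα)) (sym (unique (s ∘ β) (classified pbβ))))
    where
      open PartialMapClassifier TC
      classified : ∀ {γ} → IsPullback id m t γ → IsPullback m id (s ∘ γ) (η L)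
      classified {γ} pb =
        subst (IsPullback m id (s ∘ γ)) st≡η (pullback-swap (pullback-postcompose-mono s-mono pb))

  module _ {ρ : Rule} where
    open Rule ρ

    step-adherence-unique : Classifying ρ → ∀ {GL GR GR′} {m : Hom L GL} {α β : Hom GL L'} →
                            Step ρ m α GR → Step ρ m β GR′ → α ≡ β
    step-adherence-unique (tL-regular , tL-restricted) S₁ S₂ =
      restricted-classifier-pullback-unique tL-regular tL-restricted (Step.pb-m S₁) (Step.pb-m S₂)

    step-result-unique : ∀ {GL GR GR′} {m : Hom L GL} {α : Hom GL L'} →
                         Step ρ m α GR → Step ρ m α GR′ → GR ≅ GR′
    step-result-unique S₁ S₂ =
      let (φ , (_ , u′φ≡u′) , φ-iso) = pullbacks-iso A.pb-GK B.pb-GK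
          φu≡u = B.u-uniq (φ ∘ A.u) (paste-triangles u′φ≡u′ A.u'u)
      in pushouts-iso-along A.po B.po φ φ-iso φu≡u
      where
        module A = Step S₁
        module B = Step S₂

theorem1 : ∀ {o ℓ} (C : Category o ℓ) →
           let open Cat C in
           IsQuasitopos → (ρ : Rule) → Classifying ρ →
           ∀ {GL GR GR' : Category.Obj C} (m : Category.Hom C (Rule.L ρ) GL) (α β : Category.Hom C GL (Rule.L' ρ)) →
           Step ρ m α GR → Step ρ m β GR' →
           (α ≡ β) × (GR ≅ GR')
theorem1 C _ ρ classifying m α β S₁ S₂
  with refl ← step-adherence-unique C classifying S₁ S₂
  = refl , step-result-unique C S₁ S₂
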